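{- Let $\mathcal{G}$ be a finite simple undirected graph and let $\mathcal{H}_2$ be the set of subgraphs of $\mathcal{G}$ isomorphic to $K_2$ (i.e., edges, each identified with the subgraph induced by its endvertices). Suppose two elements of $\mathcal{H}_2$ share a common vertex, each of them is a proper F-twin, and they belong to different F-twin equivalence classes of $\mathcal{H}_2$. Then $\mathcal{G}$ contains the cycle $C_6$ as an induced subgraph.
   Context: All graphs are finite, undirected, without loops or parallel edges. For a vertex $u$, $\mathcal{N}(u)$ denotes the set of vertices adjacent to $u$. Two induced subgraphs $H_1,H_2$ of $\mathcal{G}$ with vertex sets $V_1,V_2$ are called F-twins if there is a graph isomorphism $\varphi:V_1\to V_2$ between $H_1$ and $H_2$ such that $\mathcal{N}(u)-V_1=\mathcal{N}(\varphi(u))-V_2$ for all $u\in V_1$. The F-twin relation is an equivalence relation on $\mathcal{H}_2$. An induced subgraph is a proper F-twin if it has an F-twin different from itself. -}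

module Defs where

open import Data.Nat using (ℕ; suc; _+_; _%_)
open import Data.Bool using (Bool; true; false)
open import Data.Fin using (Fin; toℕ)
open import Data.Fin.Subset using (Subset; _∈_; _∉_; _∪_; ⁅_⁆)
open import Data.Product using (Σ; ∃; _×_; _,_; proj₁)
open import Data.Sum using (_⊎_)
open import Function.Bundles using (Bijection; _⇔_)
open import Function.Definitions using (Injective)
open import Relation.Binary.PropositionalEquality using (_≡_)
open import Relation.Nullary using (¬_)
open import Relation.Nullary.Decidable using (⌊_⌋)
open import Data.Nat.Properties using (_≟_)
open import Data.Bool using (_∨_)

record Graph (n : ℕ) : Set where
  field
    adj    : Fin n → Fin n → Bool
    sym    : ∀ u v → adj u v ≡ adj v u
    irrefl : ∀ u → adj u u ≡ false
open Graph public

module _ {n : ℕ} (G : Graph n) where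

  _~_ : Fin n → Fin n → Set
  u ~ v = adj G u v ≡ true

  Vert : Subset n → Set
  Vert V = Σ (Fin n) (_∈ V)

  -- H₁ = G[V₁] and H₂ = G[V₂] are F-twins: there is a graph isomorphism
  -- φ : V₁ → V₂ with 𝒩(u) − V₁ = 𝒩(φ u) − V₂ for all u ∈ V₁.
  FTwin : Subset n → Subset n → Set
  FTwin V₁ V₂ =
    Σ (Bijection (≡-setoid′ V₁) (≡-setoid′ V₂)) λ φ →
      let f = Bijection.to φ in
      (∀ a b → adj G (proj₁ a) (proj₁ b) ≡ adj G (proj₁ (f a)) (proj₁ (f b)))
      × (∀ a w → ((proj₁ a ~ w) × w ∉ V₁) ⇔ ((proj₁ (f a) ~ w) × w ∉ V₂))
    where
      open import Relation.Binary.PropositionalEquality using () renaming (setoid to ≡-setoid)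
      ≡-setoid′ : Subset n → _
      ≡-setoid′ V = ≡-setoid (Vert V)

  IsEdge : Subset n → Set
  IsEdge V = ∃ λ u → ∃ λ v → (u ~ v) × (V ≡ ⁅ u ⁆ ∪ ⁅ v ⁆)

  H₂ : Set
  H₂ = Σ (Subset n) IsEdge

  ProperFTwin : Subset n → Set
  ProperFTwin V = ∃ λ W → FTwin V W × ¬ (W ≡ V)

  c6adj : Fin 6 → Fin 6 → Bool
  c6adj i j = ⌊ toℕ j ≟ (toℕ i + 1) % 6 ⌋ ∨ ⌊ toℕ i ≟ (toℕ j + 1) % 6 ⌋

  HasInducedC6 : Set
  HasInducedC6 = Σ (Fin 6 → Fin n) λ f → Injective _≡_ _≡_ f × (∀ i j → adj G (f i) (f j) ≡ c6adj i j)

-- An F-twin map u ↦ x, v ↦ y from an edge uv onto a different edge xy forces the two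
-- edges to be disjoint with no edges between them, and u, x (resp. v, y) to have the
-- same neighbours outside the two edges.  Now let uv and uw be such edges at a common
-- vertex u, twinned with xy and ab.  Then w ~ x and v ~ a, hence a ~ y; and v ~ w is
-- impossible, since it would give y ~ w and then u ~ y.  So u v a y x w is an induced C₆.
module Submission where

open import Defs renaming (sym to adj-sym; irrefl to adj-irrefl)
open import Data.Nat using (ℕ)
open import Data.Bool using (true; false)
open import Data.Bool.Properties using (⇔→≡; ¬-not)
import Data.Bool.Properties as Bool
open import Data.Fin using (Fin; zero; suc) renaming (_≟_ to _≟ᶠ_)
open import Data.Fin.Properties using (all?; any?)
open import Data.Fin.Subset using (Subset; _∈_; _∉_; _∪_; ⁅_⁆)
open import Data.Fin.Subset.Properties using (x∈p∪q⁻; x∈p∪q⁺; x∈⁅x⁆; x∈⁅y⁆⇒x≡y; ⊆-antisym; ∪-comm)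
open import Data.Product using (∃; ∃₂; _×_; _,_; proj₁; proj₂)
open import Data.Sum using (_⊎_; inj₁; inj₂)
open import Data.Unit using (tt)
open import Data.Vec using (here; there)
open import Function.Bundles using (Bijection; _⇔_; mk⇔; module Equivalence)
import Function.Construct.Identity as Identity
open import Relation.Binary.PropositionalEquality
open import Relation.Nullary using (¬_; ¬?; yes; no; contradiction; _⊎-dec_)
open import Relation.Nullary.Decidable using (toWitness)

open Equivalence using (to; from)

∈-irrelevant : ∀ {n} {x : Fin n} {p : Subset n} (a b : x ∈ p) → a ≡ b
∈-irrelevant here      here      = refl
∈-irrelevant (there a) (there b) = cong there (∈-irrelevant a b)

module _ {n : ℕ} where

  pair : Fin n → Fin n → Subset n
  pair u v = ⁅ u ⁆ ∪ ⁅ v ⁆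

  ∈-pairˡ : ∀ {u v} → u ∈ pair u v
  ∈-pairˡ {u} = x∈p∪q⁺ (inj₁ (x∈⁅x⁆ u))

  ∈-pairʳ : ∀ {u v} → v ∈ pair u v
  ∈-pairʳ {u} {v} = x∈p∪q⁺ {p = ⁅ u ⁆} (inj₂ (x∈⁅x⁆ v))

  ∈-pair⁻ : ∀ {u v z} → z ∈ pair u v → z ≡ u ⊎ z ≡ v
  ∈-pair⁻ {u} {v} z∈ with x∈p∪q⁻ ⁅ u ⁆ ⁅ v ⁆ z∈
  ... | inj₁ z∈u = inj₁ (x∈⁅y⁆⇒x≡y u z∈u)
  ... | inj₂ z∈v = inj₂ (x∈⁅y⁆⇒x≡y v z∈v)

  ∉-pair : ∀ {u v z} → z ≢ u → z ≢ v → z ∉ pair u v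
  ∉-pair z≢u z≢v z∈ with ∈-pair⁻ z∈
  ... | inj₁ z≡u = z≢u z≡u
  ... | inj₂ z≡v = z≢v z≡v

  pair-comm : ∀ u v → pair u v ≡ pair v u
  pair-comm u v = ∪-comm ⁅ u ⁆ ⁅ v ⁆

pattern #0 = zero
pattern #1 = suc #0
pattern #2 = suc #1
pattern #3 = suc #2
pattern #4 = suc #3
pattern #5 = suc #4

module _ {n : ℕ} (G : Graph n) where

  adj-flip : ∀ {u v b} → adj G u v ≡ b → adj G v u ≡ b
  adj-flip {u} {v} uv = trans (adj-sym G v u) uv

  adj⇒≢ : ∀ {u v} → adj G u v ≡ true → u ≢ v
  adj⇒≢ {u} u~u refl with () ← trans (sym u~u) (adj-irrefl G u)

  FTwin-refl : ∀ V → FTwin G V V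
  FTwin-refl V = Identity.bijection _ , (λ _ _ → refl) , (λ _ _ → Identity.⇔-id _)

  edge-through : ∀ {u v s} → adj G u v ≡ true → s ∈ pair u v →
                 ∃ λ t → adj G s t ≡ true × pair u v ≡ pair s t
  edge-through {u} {v} u~v s∈ with ∈-pair⁻ s∈
  ... | inj₁ refl = v , u~v , refl
  ... | inj₂ refl = u , adj-flip u~v , pair-comm u v

  c6adj-separates : ∀ i j → i ≡ j ⊎ ∃ λ k → c6adj G k i ≢ c6adj G k j
  c6adj-separates = toWitness {a? = all? λ i → all? λ j →
    i ≟ᶠ j ⊎-dec any? λ k → ¬? (c6adj G k i Bool.≟ c6adj G k j)} tt

  induced-C6 : (c : Fin 6 → Fin n) → (∀ i j → adj G (c i) (c j) ≡ c6adj G i j) → HasInducedC6 G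
  induced-C6 c c-adj = c , injective , c-adj
    where
      injective : ∀ {i j} → c i ≡ c j → i ≡ j
      injective {i} {j} ci≡cj with c6adj-separates i j
      ... | inj₁ i≡j = i≡j
      ... | inj₂ (k , differ) =
        contradiction (trans (sym (c-adj k i)) (trans (cong (adj G (c k)) ci≡cj) (c-adj k j))) differ

  hexagon-induced-C6 : ∀ {c₀ c₁ c₂ c₃ c₄ c₅} →
    adj G c₀ c₁ ≡ true → adj G c₁ c₂ ≡ true → adj G c₂ c₃ ≡ true →
    adj G c₃ c₄ ≡ true → adj G c₄ c₅ ≡ true → adj G c₀ c₅ ≡ true →
    adj G c₀ c₂ ≡ false → adj G c₀ c₃ ≡ false → adj G c₀ c₄ ≡ false →
    adj G c₁ c₃ ≡ false → adj G c₁ c₄ ≡ false → adj G c₁ c₅ ≡ false →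
    adj G c₂ c₄ ≡ false → adj G c₂ c₅ ≡ false → adj G c₃ c₅ ≡ false →
    HasInducedC6 G
  hexagon-induced-C6 {c₀} {c₁} {c₂} {c₃} {c₄} {c₅}
    e₀₁ e₁₂ e₂₃ e₃₄ e₄₅ e₀₅ n₀₂ n₀₃ n₀₄ n₁₃ n₁₄ n₁₅ n₂₄ n₂₅ n₃₅ = induced-C6 c c-adj
    where
      c : Fin 6 → Fin n
      c #0 = c₀
      c #1 = c₁
      c #2 = c₂
      c #3 = c₃
      c #4 = c₄
      c #5 = c₅
      c-adj : ∀ i j → adj G (c i) (c j) ≡ c6adj G i j
      c-adj #0 #0 = adj-irrefl G c₀
      c-adj #0 #1 = e₀₁
      c-adj #0 #2 = n₀₂
      c-adj #0 #3 = n₀₃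
      c-adj #0 #4 = n₀₄
      c-adj #0 #5 = e₀₅
      c-adj #1 #0 = adj-flip e₀₁
      c-adj #1 #1 = adj-irrefl G c₁
      c-adj #1 #2 = e₁₂
      c-adj #1 #3 = n₁₃
      c-adj #1 #4 = n₁₄
      c-adj #1 #5 = n₁₅
      c-adj #2 #0 = adj-flip n₀₂
      c-adj #2 #1 = adj-flip e₁₂
      c-adj #2 #2 = adj-irrefl G c₂
      c-adj #2 #3 = e₂₃
      c-adj #2 #4 = n₂₄
      c-adj #2 #5 = n₂₅
      c-adj #3 #0 = adj-flip n₀₃
      c-adj #3 #1 = adj-flip n₁₃
      c-adj #3 #2 = adj-flip e₂₃
      c-adj #3 #3 = adj-irrefl G c₃
      c-adj #3 #4 = e₃₄
      c-adj #3 #5 = n₃₅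
      c-adj #4 #0 = adj-flip n₀₄
      c-adj #4 #1 = adj-flip n₁₄
      c-adj #4 #2 = adj-flip n₂₄
      c-adj #4 #3 = adj-flip e₃₄
      c-adj #4 #4 = adj-irrefl G c₄
      c-adj #4 #5 = e₄₅
      c-adj #5 #0 = adj-flip e₀₅
      c-adj #5 #1 = adj-flip n₁₅
      c-adj #5 #2 = adj-flip n₂₅
      c-adj #5 #3 = adj-flip n₃₅
      c-adj #5 #4 = adj-flip e₄₅
      c-adj #5 #5 = adj-irrefl G c₅

  record TwinEdges (u v x y : Fin n) : Set where
    field
      x~y : adj G x y ≡ true
      x≢u : x ≢ u
      x≢v : x ≢ v
      y≢u : y ≢ u
      y≢v : y ≢ v
      u≁x : adj G u x ≡ false
      u≁y : adj G u y ≡ false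
      v≁x : adj G v x ≡ false
      v≁y : adj G v y ≡ false
      u≗x : ∀ z → z ≢ v → z ≢ y → adj G u z ≡ adj G x z
      v≗y : ∀ z → z ≢ u → z ≢ x → adj G v z ≡ adj G y z

  module TwinVertex {u v x y : Fin n} {V W : Subset n}
    (V≡uv : V ≡ pair u v) (W≡xy : W ≡ pair x y) (W≢V : W ≢ V) (u~v : adj G u v ≡ true)
    (match : ∀ z → (adj G u z ≡ true × z ∉ V) ⇔ (adj G x z ≡ true × z ∉ W)) where

    v∈V : v ∈ V
    v∈V = subst (v ∈_) (sym V≡uv) ∈-pairʳ

    x∈W : x ∈ W
    x∈W = subst (x ∈_) (sym W≡xy) ∈-pairˡ

    ∉V : ∀ {z} → z ≢ u → z ≢ v → z ∉ V
    ∉V z≢u z≢v = subst (_ ∉_) (sym V≡uv) (∉-pair z≢u z≢v)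

    ∉W : ∀ {z} → z ≢ x → z ≢ y → z ∉ W
    ∉W z≢x z≢y = subst (_ ∉_) (sym W≡xy) (∉-pair z≢x z≢y)

    x≢u : x ≢ u
    x≢u refl with y ≟ᶠ v
    ... | yes refl = W≢V (trans W≡xy (sym V≡uv))
    ... | no y≢v = proj₂ (from (match v) (u~v , ∉W (≢-sym (adj⇒≢ u~v)) (≢-sym y≢v))) v∈V

    x≢v : x ≢ v
    x≢v refl with y ≟ᶠ u
    ... | yes refl = W≢V (trans W≡xy (trans (pair-comm x u) (sym V≡uv)))
    ... | no y≢u = adj⇒≢ (proj₁ (from (match u) (adj-flip u~v , ∉W (adj⇒≢ u~v) (≢-sym y≢u)))) refl

    u≁W : ∀ {z} → z ∈ W → z ≢ u → z ≢ v → adj G u z ≡ false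
    u≁W z∈W z≢u z≢v = ¬-not λ u~z → proj₂ (to (match _) (u~z , ∉V z≢u z≢v)) z∈W

    u≁x : adj G u x ≡ false
    u≁x = u≁W x∈W x≢u x≢v

    u≗x : ∀ z → z ≢ v → z ≢ y → adj G u z ≡ adj G x z
    u≗x z z≢v z≢y with z ≟ᶠ u | z ≟ᶠ x
    ... | yes refl | _ = trans (adj-irrefl G z) (sym (adj-flip u≁x))
    ... | no _ | yes refl = trans u≁x (sym (adj-irrefl G z))
    ... | no z≢u | no z≢x = ⇔→≡ (mk⇔
      (λ u~z → proj₁ (to (match z) (u~z , ∉V z≢u z≢v)))
      (λ x~z → proj₁ (from (match z) (x~z , ∉W z≢x z≢y))))

  twinEdges : ∀ {u v x y W} → W ≡ pair x y → W ≢ pair u v →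
    adj G u v ≡ true → adj G x y ≡ true →
    (∀ z → (adj G u z ≡ true × z ∉ pair u v) ⇔ (adj G x z ≡ true × z ∉ W)) →
    (∀ z → (adj G v z ≡ true × z ∉ pair u v) ⇔ (adj G y z ≡ true × z ∉ W)) →
    TwinEdges u v x y
  twinEdges {u} {v} {x} {y} W≡xy W≢V u~v x~y match-u match-v = record
    { x~y = x~y
    ; x≢u = U.x≢u ; x≢v = U.x≢v ; y≢u = V.x≢v ; y≢v = V.x≢u
    ; u≁x = U.u≁x ; u≁y = U.u≁W V.x∈W V.x≢v V.x≢u
    ; v≁x = V.u≁W U.x∈W U.x≢v U.x≢u ; v≁y = V.u≁x
    ; u≗x = U.u≗x ; v≗y = V.u≗x }
    where
      module U = TwinVertex refl W≡xy W≢V u~v match-u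
      module V = TwinVertex (pair-comm u v) (trans W≡xy (pair-comm x y)) W≢V (adj-flip u~v) match-v

  properFTwin⇒twinEdges : ∀ {u v} → adj G u v ≡ true → ProperFTwin G (pair u v) →
                          ∃₂ λ x y → TwinEdges u v x y
  properFTwin⇒twinEdges {u} {v} u~v (W , (φ , adj-pres , match) , W≢V) =
    x , y , twinEdges W≡xy W≢V u~v x~y (match (u , ∈-pairˡ)) (match (v , ∈-pairʳ))
    where
      f = Bijection.to φ
      x = proj₁ (f (u , ∈-pairˡ))
      y = proj₁ (f (v , ∈-pairʳ))

      x~y : adj G x y ≡ true
      x~y = trans (sym (adj-pres (u , ∈-pairˡ) (v , ∈-pairʳ))) u~v

      image : ∀ {t} (t∈ : t ∈ pair u v) → proj₁ (f (t , t∈)) ∈ pair x y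
      image t∈ with ∈-pair⁻ t∈
      ... | inj₁ refl = subst (λ p → proj₁ (f (_ , p)) ∈ pair x y) (∈-irrelevant ∈-pairˡ t∈) ∈-pairˡ
      ... | inj₂ refl = subst (λ p → proj₁ (f (_ , p)) ∈ pair x y) (∈-irrelevant ∈-pairʳ t∈) ∈-pairʳ

      W⊆xy : ∀ {z} → z ∈ W → z ∈ pair x y
      W⊆xy z∈W with Bijection.surjective φ (_ , z∈W)
      ... | (_ , t∈) , f≡ = subst (_∈ pair x y) (cong proj₁ (f≡ refl)) (image t∈)

      xy⊆W : ∀ {z} → z ∈ pair x y → z ∈ W
      xy⊆W z∈ with ∈-pair⁻ z∈
      ... | inj₁ refl = proj₂ (f (u , ∈-pairˡ))
      ... | inj₂ refl = proj₂ (f (v , ∈-pairʳ))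

      W≡xy : W ≡ pair x y
      W≡xy = ⊆-antisym W⊆xy xy⊆W

  twinEdges-at-vertex⇒C6 : ∀ {u v w x y a b} → adj G u v ≡ true → adj G u w ≡ true → w ≢ v →
                           TwinEdges u v x y → TwinEdges u w a b → HasInducedC6 G
  twinEdges-at-vertex⇒C6 {u} {v} {w} {x} {y} {a} {b} u~v u~w w≢v T S =
    hexagon-induced-C6 u~v (adj-flip a~v) a~y (adj-flip T.x~y) x~w u~w
                       S.u≁x T.u≁y T.u≁x T.v≁y T.v≁x v≁w a≁x (adj-flip S.v≁x) y≁w
    where
      module T = TwinEdges T
      module S = TwinEdges S

      w≢y : w ≢ y
      w≢y refl = contradiction (trans (sym u~w) T.u≁y) λ ()

      v≢b : v ≢ b
      v≢b refl = contradiction (trans (sym u~v) S.u≁y) λ ()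

      x~w : adj G x w ≡ true
      x~w = trans (sym (T.u≗x w w≢v w≢y)) u~w

      a~v : adj G a v ≡ true
      a~v = trans (sym (S.u≗x v (≢-sym w≢v) v≢b)) u~v

      a≢x : a ≢ x
      a≢x refl = contradiction (trans (sym (adj-flip a~v)) T.v≁x) λ ()

      a≢y : a ≢ y
      a≢y refl = contradiction (trans (sym (adj-flip a~v)) T.v≁y) λ ()

      a~y : adj G a y ≡ true
      a~y = adj-flip (trans (sym (T.v≗y a S.x≢u a≢x)) (adj-flip a~v))

      a≁x : adj G a x ≡ false
      a≁x = adj-flip (trans (sym (T.u≗x a (adj⇒≢ a~v) a≢y)) S.u≁x)

      -- v ~ w would give y ~ w, so y ≠ b and the twin pair (u, a) would disagree at y.
      v≁w : adj G v w ≡ false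
      v≁w = ¬-not λ v~w →
        let y~w = trans (sym (T.v≗y w (adj⇒≢ (adj-flip u~w)) (adj⇒≢ (adj-flip x~w)))) v~w
            y≢b = λ { refl → contradiction (trans (sym (adj-flip y~w)) S.v≁y) λ () }
        in contradiction (trans (sym (trans (S.u≗x y (≢-sym w≢y) y≢b) a~y)) T.u≁y) λ ()

      y≁w : adj G y w ≡ false
      y≁w = trans (sym (T.v≗y w (adj⇒≢ (adj-flip u~w)) (adj⇒≢ (adj-flip x~w)))) v≁w

  twinned-edges-at-vertex⇒C6 : ∀ {s v w} → adj G s v ≡ true → adj G s w ≡ true →
    ProperFTwin G (pair s v) → ProperFTwin G (pair s w) → ¬ FTwin G (pair s v) (pair s w) →
    HasInducedC6 G
  twinned-edges-at-vertex⇒C6 {v = v} {w} s~v s~w sv-twin sw-twin sv≁sw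
    with properFTwin⇒twinEdges s~v sv-twin | properFTwin⇒twinEdges s~w sw-twin
  ... | _ , _ , T | _ , _ , S = twinEdges-at-vertex⇒C6 s~v s~w w≢v T S
    where
      w≢v : w ≢ v
      w≢v refl = sv≁sw (FTwin-refl _)

proposition6 : {n : ℕ} (G : Graph n) (e f : H₂ G) →
    ∃ (λ w → w ∈ proj₁ e × w ∈ proj₁ f) →
    ProperFTwin G (proj₁ e) → ProperFTwin G (proj₁ f) →
    ¬ FTwin G (proj₁ e) (proj₁ f) →
    HasInducedC6 G
proposition6 G (_ , e₁ , e₂ , e₁~e₂ , refl) (_ , f₁ , f₂ , f₁~f₂ , refl) (s , s∈e , s∈f) e-twin f-twin e≁f
  with edge-through G e₁~e₂ s∈e | edge-through G f₁~f₂ s∈f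
... | v , s~v , e≡sv | w , s~w , f≡sw =
  twinned-edges-at-vertex⇒C6 G s~v s~w
    (subst (ProperFTwin G) e≡sv e-twin) (subst (ProperFTwin G) f≡sw f-twin)
    (subst₂ (λ V W → ¬ FTwin G V W) e≡sv f≡sw e≁f)
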